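{- For every finite simple digraph $D$, \[\mu(D)=\max_{C\in SCC(D)}\mu(C),\] where $SCC(D)$ is the set of strongly connected components of $D$, each regarded as the subdigraph of $D$ it induces.
   Context: A digraph $D=(V,A)$ has a finite vertex set and arcs that are ordered pairs of distinct vertices, with no parallel arcs. Directed paths have distinct vertices; a shortest directed $x,y$-path is a directed path from $x$ to $y$ of minimum length. A set $S\subseteq V(D)$ is a mutual-visibility set of $D$ if for all distinct $x,y\in S$ there exist a shortest directed $x,y$-path $P$ and a shortest directed $y,x$-path $Q$ such that $(S\cap V(P))\cup(S\cap V(Q))=\{x,y\}$. The mutual-visibility number $\mu(D)$ is the maximum size of a mutual-visibility set of $D$. A strongly connected component is a maximal set of pairwise mutually reachable vertices. -}

module Defs where

open import Data.Nat using (ℕ; zero; suc; _≤_)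
open import Data.Fin using (Fin)
open import Data.Fin.Subset using (Subset; _∈_; _⊆_; ∣_∣; Nonempty)
open import Data.Bool using (Bool; true; false)
open import Data.List using (List; []; _∷_)
open import Data.List.Relation.Unary.Unique.Propositional using (Unique)
import Data.List.Membership.Propositional as LM
open import Data.Product using (Σ; _×_; ∃; _,_; proj₁)
open import Data.Sum using (_⊎_)
open import Relation.Binary.PropositionalEquality using (_≡_; _≢_)

-- The vertex set is the subset 'verts'; the arc set is
--   { (x , y) | arc x y ≡ true , x ∈ verts , y ∈ verts }.
-- Arcs are ordered pairs of distinct vertices (no loops); a Bool-valued
-- adjacency rules out parallel arcs.  Carrying the vertex set as a subset
-- of the label set lets induced subdigraphs be digraphs of the same kind.
record Digraph (n : ℕ) : Set where
  field
    verts    : Subset n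
    arc      : Fin n → Fin n → Bool
    loopless : ∀ x → arc x x ≡ false
open Digraph public

Arc : ∀ {n} → Digraph n → Fin n → Fin n → Set
Arc D x y = (arc D x y ≡ true) × (x ∈ verts D) × (y ∈ verts D)

induced : ∀ {n} → (D : Digraph n) → Subset n → Digraph n
induced D C = record { verts = C ; arc = arc D ; loopless = loopless D }

data Walk {n} (D : Digraph n) : Fin n → Fin n → ℕ → Set where
  here : ∀ {x} → x ∈ verts D → Walk D x x zero
  step : ∀ {x y z k} → Arc D x y → Walk D y z k → Walk D x z (suc k)

walkVerts : ∀ {n} {D : Digraph n} {x y k} → Walk D x y k → List (Fin n)
walkVerts (here {x} _) = x ∷ []
walkVerts (step {x} _ w) = x ∷ walkVerts w

Path : ∀ {n} → Digraph n → Fin n → Fin n → ℕ → Set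
Path D x y k = Σ (Walk D x y k) λ w → Unique (walkVerts w)

pathVerts : ∀ {n} {D : Digraph n} {x y k} → Path D x y k → List (Fin n)
pathVerts (w , _) = walkVerts w

ShortestPath : ∀ {n} → Digraph n → Fin n → Fin n → ℕ → Set
ShortestPath D x y k =
  Path D x y k × (∀ k' → Path D x y k' → k ≤ k')

IsMutualVisibility : ∀ {n} → Digraph n → Subset n → Set
IsMutualVisibility {n} D S =
  S ⊆ verts D ×
  (∀ x y → x ∈ S → y ∈ S → x ≢ y →
    Σ ℕ λ k → Σ ℕ λ l →
    Σ (ShortestPath D x y k) λ P → Σ (ShortestPath D y x l) λ Q →
      (∀ z → z ∈ S → (z LM.∈ pathVerts (proj₁ P) ⊎ z LM.∈ pathVerts (proj₁ Q)) →
         z ≡ x ⊎ z ≡ y))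

IsMu : ∀ {n} → Digraph n → ℕ → Set
IsMu {n} D k =
  (Σ (Subset n) λ S → IsMutualVisibility D S × ∣ S ∣ ≡ k) ×
  (∀ S → IsMutualVisibility D S → ∣ S ∣ ≤ k)

Reachable : ∀ {n} → Digraph n → Fin n → Fin n → Set
Reachable D x y = Σ ℕ λ k → Path D x y k

MutuallyReachable : ∀ {n} → Digraph n → Subset n → Set
MutuallyReachable D C =
  C ⊆ verts D × (∀ x y → x ∈ C → y ∈ C → Reachable D x y × Reachable D y x)

IsSCC : ∀ {n} → Digraph n → Subset n → Set
IsSCC {n} D C =
  Nonempty C × MutuallyReachable D C ×
  (∀ C' → C ⊆ C' → MutuallyReachable D C' → C' ⊆ C)

{-# OPTIONS --safe #-}
-- Two distinct vertices of a mutual-visibility set are joined by directed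
-- paths in both directions, so a nonempty mutual-visibility set lies inside a
-- single strongly connected component C.  A walk between two vertices of C
-- never leaves C, so D and D[C] have the same shortest paths between vertices
-- of C, and a subset of C is a mutual-visibility set of D[C] iff it is one of
-- D.  Hence μ(D[C]) ≤ μ(D) for every component C, with equality for the
-- component containing a maximum mutual-visibility set of D.
module Submission where

open import Defs
open import Data.Nat using (ℕ; _≤_)
open import Data.Fin.Subset using (Subset; Nonempty)
open import Data.Product using (Σ; _×_)

open import Level using (Level)
open import Data.Nat using (zero; suc; _+_; _<_)
open import Data.Fin using (Fin; zero; suc; toℕ; fromℕ<; _≟_)
open import Data.Fin.Properties using (any?; injective⇒≤; toℕ-fromℕ<)
open import Data.Fin.Subset using (_∈_; _⊆_; _∪_; ⁅_⁆)
open import Data.Fin.Subset.Properties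
  using (_∈?_; nonempty?; p⊆p∪q; x∈p∪q⁻; x∈p∪q⁺; x∈⁅x⁆; x∈⁅y⁆⇒x≡y)
open import Data.Bool using (true)
open import Data.Bool.Properties using () renaming (_≟_ to _≟ᵇ_)
open import Data.Vec using (tabulate)
open import Data.Vec.Properties using (lookup∘tabulate; []=⇒lookup; lookup⇒[]=)
open import Data.List using (List; []; _∷_; length; lookup)
open import Data.List.Membership.Propositional using () renaming (_∈_ to _∈ₗ_)
open import Data.List.Membership.Propositional.Properties using (∈-lookup)
import Data.List.Relation.Unary.Any as Any
open import Data.List.Relation.Unary.Any using (here; there)
import Data.List.Relation.Unary.All as All
open import Data.List.Relation.Unary.All using (All; []; _∷_)
open import Data.List.Relation.Unary.All.Properties using (¬Any⇒All¬)
open import Data.List.Relation.Unary.AllPairs using ([]; _∷_)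
open import Data.List.Relation.Unary.Unique.Propositional using (Unique)
open import Data.Product as Product using (∃; _,_; proj₁; proj₂; swap)
open import Data.Sum as Sum using (_⊎_; inj₁; inj₂)
open import Data.Empty using (⊥-elim)
open import Function using (_∘_; Injective)
open import Relation.Nullary using (Dec; yes; no; does)
open import Relation.Nullary.Decidable using (_×-dec_; map′; dec-true)
open import Relation.Unary using (Pred; Decidable)
open import Relation.Binary.PropositionalEquality using (_≡_; refl; sym; trans; cong; subst)

private variable
  ℓ : Level
  n k l : ℕ
  D : Digraph n
  C T : Subset n
  x y z : Fin n

lookup-injective : ∀ {A : Set} {xs : List A} → Unique xs → Injective _≡_ _≡_ (lookup xs)
lookup-injective (_ ∷ _) {zero} {zero} _ = refl
lookup-injective (x∉xs ∷ _) {zero} {suc j} eq = ⊥-elim (All.lookup x∉xs (∈-lookup j) eq)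
lookup-injective (x∉xs ∷ _) {suc i} {zero} eq =
  ⊥-elim (All.lookup x∉xs (∈-lookup i) (sym eq))
lookup-injective (_ ∷ u) {suc i} {suc j} eq = cong suc (lookup-injective u eq)

Unique⇒length≤ : {xs : List (Fin n)} → Unique xs → length xs ≤ n
Unique⇒length≤ u = injective⇒≤ (lookup-injective u)

fromDec : {P : Pred (Fin n) ℓ} → Decidable P → Subset n
fromDec P? = tabulate (does ∘ P?)

∈-fromDec⁺ : {P : Pred (Fin n) ℓ} (P? : Decidable P) → ∀ {x} → P x → x ∈ fromDec P?
∈-fromDec⁺ P? {x} px = lookup⇒[]= x _ (trans (lookup∘tabulate _ x) (dec-true (P? x) px))

∈-fromDec⁻ : {P : Pred (Fin n) ℓ} (P? : Decidable P) → ∀ {x} → x ∈ fromDec P? → P x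
∈-fromDec⁻ P? {x} x∈P
  with P? x | trans (sym (lookup∘tabulate (does ∘ P?) x)) ([]=⇒lookup x∈P)
... | yes px | _ = px
... | no _ | ()

walk-source∈ : Walk D x y k → x ∈ verts D
walk-source∈ (here x∈V) = x∈V
walk-source∈ (step (_ , x∈V , _) _) = x∈V

source∈walkVerts : (w : Walk D x y k) → x ∈ₗ walkVerts w
source∈walkVerts (here _) = here refl
source∈walkVerts (step _ _) = here refl

length-walkVerts : (w : Walk D x y k) → length (walkVerts w) ≡ suc k
length-walkVerts (here _) = refl
length-walkVerts (step _ w) = cong suc (length-walkVerts w)

_++ʷ_ : Walk D x y k → Walk D y z l → Walk D x z (k + l)
here _ ++ʷ v = v
step xy w ++ʷ v = step xy (w ++ʷ v)

walk-split : (w : Walk D x y k) → z ∈ₗ walkVerts w →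
             (∃ λ i → Walk D x z i) × (∃ λ j → Walk D z y j)
walk-split w@(here _) (here refl) = (_ , w) , (_ , w)
walk-split w@(step (_ , x∈V , _) _) (here refl) = (_ , here x∈V) , (_ , w)
walk-split (step xy w) (there z∈w) with walk-split w z∈w
... | (i , prefix) , suffix = (suc i , step xy prefix) , suffix

path-length< : {D : Digraph n} {x y : Fin n} → Path D x y k → k < n
path-length< (w , u) = subst (_≤ _) (length-walkVerts w) (Unique⇒length≤ u)

path-suffix : (P : Path D x y k) → z ∈ₗ pathVerts P → Reachable D z y
path-suffix P@(here _ , _) (here refl) = _ , P
path-suffix P@(step _ _ , _) (here refl) = _ , P
path-suffix (step _ w , _ ∷ u) (there z∈w) = path-suffix (w , u) z∈w

reachable-refl : x ∈ verts D → Reachable D x x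
reachable-refl x∈V = 0 , here x∈V , [] ∷ []

reachable-source∈ : Reachable D x y → x ∈ verts D
reachable-source∈ (_ , w , _) = walk-source∈ w

walk⇒reachable : Walk D x y k → Reachable D x y
walk⇒reachable (here x∈V) = reachable-refl x∈V
walk⇒reachable (step {x} xy w) with walk⇒reachable w
... | k , P with Any.any? (x ≟_) (pathVerts P)
...   | yes x∈P = path-suffix P x∈P
...   | no x∉P = suc k , step xy (proj₁ P) , ¬Any⇒All¬ _ x∉P ∷ proj₂ P

reachable-trans : Reachable D x y → Reachable D y z → Reachable D x z
reachable-trans (_ , v , _) (_ , w , _) = walk⇒reachable (v ++ʷ w)

arc? : (D : Digraph n) → ∀ x y → Dec (Arc D x y)
arc? D x y = (arc D x y ≟ᵇ true) ×-dec (x ∈? verts D) ×-dec (y ∈? verts D)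

walk? : (D : Digraph n) → ∀ x y k → Dec (Walk D x y k)
walk? D x y zero =
  map′ (λ { (refl , x∈V) → here x∈V }) (λ { (here x∈V) → refl , x∈V })
       ((x ≟ y) ×-dec (x ∈? verts D))
walk? D x y (suc k) =
  map′ (λ (_ , xz , w) → step xz w) (λ { (step xz w) → _ , xz , w })
       (any? λ z → arc? D x z ×-dec walk? D z y k)

reachable? : (D : Digraph n) → ∀ x y → Dec (Reachable D x y)
reachable? {n} D x y =
  map′ (walk⇒reachable ∘ proj₂) shortWalk (any? λ i → walk? D x y (toℕ i))
  where
  shortWalk : Reachable D x y → ∃ λ (i : Fin n) → Walk D x y (toℕ i)
  shortWalk (_ , w , u) =
    fromℕ< (path-length< (w , u)) , subst (Walk D x y) (sym (toℕ-fromℕ< _)) w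

mutuallyReachable? : (D : Digraph n) (x : Fin n) →
                     Decidable λ y → Reachable D x y × Reachable D y x
mutuallyReachable? D x y = reachable? D x y ×-dec reachable? D y x

sccOf : Digraph n → Fin n → Subset n
sccOf D x = fromDec (mutuallyReachable? D x)

∈-sccOf⁺ : Reachable D x y → Reachable D y x → y ∈ sccOf D x
∈-sccOf⁺ {D = D} {x = x} x⇝y y⇝x = ∈-fromDec⁺ (mutuallyReachable? D x) (x⇝y , y⇝x)

∈-sccOf⁻ : y ∈ sccOf D x → Reachable D x y × Reachable D y x
∈-sccOf⁻ {D = D} {x = x} = ∈-fromDec⁻ (mutuallyReachable? D x)

sccOf-isSCC : x ∈ verts D → IsSCC D (sccOf D x)
sccOf-isSCC {x = x} {D = D} x∈V = (x , x∈sccOf) , sccOf-mutuallyReachable , maximal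
  where
  x∈sccOf : x ∈ sccOf D x
  x∈sccOf = ∈-sccOf⁺ (reachable-refl x∈V) (reachable-refl x∈V)

  sccOf-mutuallyReachable : MutuallyReachable D (sccOf D x)
  sccOf-mutuallyReachable =
    (reachable-source∈ ∘ proj₂ ∘ ∈-sccOf⁻) , λ a b a∈ b∈ →
      let (x⇝a , a⇝x) = ∈-sccOf⁻ a∈; (x⇝b , b⇝x) = ∈-sccOf⁻ b∈
      in reachable-trans a⇝x x⇝b , reachable-trans b⇝x x⇝a

  maximal : ∀ C → sccOf D x ⊆ C → MutuallyReachable D C → C ⊆ sccOf D x
  maximal C sccOf⊆C (_ , C-mutual) {y} y∈C =
    let (x⇝y , y⇝x) = C-mutual x y (sccOf⊆C x∈sccOf) y∈C in ∈-sccOf⁺ x⇝y y⇝x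

mutualVisibility⇒⊆sccOf : IsMutualVisibility D T → x ∈ T → T ⊆ sccOf D x
mutualVisibility⇒⊆sccOf {x = x} (T⊆V , visible) x∈T {y} y∈T with x ≟ y
... | yes refl = ∈-sccOf⁺ (reachable-refl (T⊆V x∈T)) (reachable-refl (T⊆V x∈T))
... | no x≢y = let (k , l , (P , _) , (Q , _) , _) = visible x y x∈T y∈T x≢y
               in ∈-sccOf⁺ (k , P) (l , Q)

WalkClosed : Digraph n → Subset n → Set
WalkClosed D C =
  ∀ {x y k} (w : Walk D x y k) → x ∈ C → y ∈ C → ∀ {z} → z ∈ₗ walkVerts w → z ∈ C

∪⁅⁆-mutuallyReachable : MutuallyReachable D C → z ∈ verts D →
                         (∀ {a} → a ∈ C → Reachable D a z × Reachable D z a) →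
                         MutuallyReachable D (C ∪ ⁅ z ⁆)
∪⁅⁆-mutuallyReachable {D = D} {C} {z} (C⊆V , C-mutual) z∈V C~z = C∪z⊆V , C∪z-mutual
  where
  ∈-∪⁅⁆ : ∀ {a} → a ∈ C ∪ ⁅ z ⁆ → a ∈ C ⊎ a ≡ z
  ∈-∪⁅⁆ = Sum.map₂ (x∈⁅y⁆⇒x≡y z) ∘ x∈p∪q⁻ C ⁅ z ⁆

  C∪z⊆V : C ∪ ⁅ z ⁆ ⊆ verts D
  C∪z⊆V a∈ with ∈-∪⁅⁆ a∈
  ... | inj₁ a∈C = C⊆V a∈C
  ... | inj₂ refl = z∈V

  C∪z-mutual : ∀ a b → a ∈ C ∪ ⁅ z ⁆ → b ∈ C ∪ ⁅ z ⁆ →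
               Reachable D a b × Reachable D b a
  C∪z-mutual a b a∈ b∈ with ∈-∪⁅⁆ a∈ | ∈-∪⁅⁆ b∈
  ... | inj₁ a∈C | inj₁ b∈C = C-mutual a b a∈C b∈C
  ... | inj₁ a∈C | inj₂ refl = C~z a∈C
  ... | inj₂ refl | inj₁ b∈C = swap (C~z b∈C)
  ... | inj₂ refl | inj₂ refl = reachable-refl z∈V , reachable-refl z∈V

IsSCC⇒WalkClosed : IsSCC D C → WalkClosed D C
IsSCC⇒WalkClosed {D = D} {C} (_ , C-mr@(_ , C-mutual) , maximal)
                 {x} {y} w x∈C y∈C {z} z∈w =
  maximal (C ∪ ⁅ z ⁆) (p⊆p∪q ⁅ z ⁆)
    (∪⁅⁆-mutuallyReachable C-mr (walk-source∈ z⇝y) C~z) (x∈p∪q⁺ (inj₂ (x∈⁅x⁆ z)))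
  where
  x⇝z : Walk D x z _
  x⇝z = proj₂ (proj₁ (walk-split w z∈w))

  z⇝y : Walk D z y _
  z⇝y = proj₂ (proj₂ (walk-split w z∈w))

  C~z : ∀ {a} → a ∈ C → Reachable D a z × Reachable D z a
  C~z a∈C = reachable-trans (proj₂ (C-mutual x _ x∈C a∈C)) (walk⇒reachable x⇝z)
          , reachable-trans (walk⇒reachable z⇝y) (proj₁ (C-mutual y _ y∈C a∈C))

liftWalk : C ⊆ verts D → (w : Walk (induced D C) x y k) →
           Σ (Walk D x y k) λ w′ → walkVerts w′ ≡ walkVerts w
liftWalk C⊆V (here x∈C) = here (C⊆V x∈C) , refl
liftWalk C⊆V (step {x} (xy , x∈C , y∈C) w) =
  Product.map (step (xy , C⊆V x∈C , C⊆V y∈C)) (cong (x ∷_)) (liftWalk C⊆V w)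

restrictWalk : (w : Walk D x y k) → All (_∈ C) (walkVerts w) →
               Σ (Walk (induced D C) x y k) λ w′ → walkVerts w′ ≡ walkVerts w
restrictWalk (here _) (x∈C ∷ []) = here x∈C , refl
restrictWalk (step {x} (xy , _ , _) w) (x∈C ∷ w⊆C) =
  Product.map (step (xy , x∈C , All.lookup w⊆C (source∈walkVerts w))) (cong (x ∷_))
              (restrictWalk w w⊆C)

liftPath : C ⊆ verts D → (P : Path (induced D C) x y k) →
           Σ (Path D x y k) λ P′ → pathVerts P′ ≡ pathVerts P
liftPath C⊆V (w , u) =
  let (w′ , w′≡w) = liftWalk C⊆V w in (w′ , subst Unique (sym w′≡w) u) , w′≡w

restrictPath : WalkClosed D C → x ∈ C → y ∈ C → (P : Path D x y k) →
               Σ (Path (induced D C) x y k) λ P′ → pathVerts P′ ≡ pathVerts P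
restrictPath closed x∈C y∈C (w , u) =
  let (w′ , w′≡w) = restrictWalk w (All.tabulate (closed w x∈C y∈C))
  in (w′ , subst Unique (sym w′≡w) u) , w′≡w

ShortestPathsTransfer : Digraph n → Digraph n → Subset n → Set
ShortestPathsTransfer D D′ C =
  ∀ {x y k} → x ∈ C → y ∈ C → (P : ShortestPath D x y k) →
  Σ (ShortestPath D′ x y k) λ P′ → pathVerts (proj₁ P′) ≡ pathVerts (proj₁ P)

liftShortestPath : C ⊆ verts D → WalkClosed D C → ShortestPathsTransfer (induced D C) D C
liftShortestPath C⊆V closed x∈C y∈C (P , minimal) =
  let (P′ , P′≡P) = liftPath C⊆V P
  in (P′ , λ k′ Q → minimal k′ (proj₁ (restrictPath closed x∈C y∈C Q))) , P′≡P

restrictShortestPath : C ⊆ verts D → WalkClosed D C → ShortestPathsTransfer D (induced D C) C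
restrictShortestPath C⊆V closed x∈C y∈C (P , minimal) =
  let (P′ , P′≡P) = restrictPath closed x∈C y∈C P
  in (P′ , λ k′ Q → minimal k′ (proj₁ (liftPath C⊆V Q))) , P′≡P

mutualVisibility-transfer : {D′ : Digraph n} → T ⊆ C → T ⊆ verts D′ →
                            ShortestPathsTransfer D D′ C →
                            IsMutualVisibility D T → IsMutualVisibility D′ T
mutualVisibility-transfer T⊆C T⊆V′ transfer (_ , visible) =
  T⊆V′ , λ x y x∈T y∈T x≢y →
    let (k , l , P , Q , onlyEnds) = visible x y x∈T y∈T x≢y
        (P′ , P′≡P) = transfer (T⊆C x∈T) (T⊆C y∈T) P
        (Q′ , Q′≡Q) = transfer (T⊆C y∈T) (T⊆C x∈T) Q
    in k , l , P′ , Q′ , λ z z∈T →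
         onlyEnds z z∈T ∘ Sum.map (subst (z ∈ₗ_) P′≡P) (subst (z ∈ₗ_) Q′≡Q)

scc-mutualVisibility⁻ : IsSCC D C → IsMutualVisibility (induced D C) T →
                        IsMutualVisibility D T
scc-mutualVisibility⁻ C-scc@(_ , (C⊆V , _) , _) T-mv@(T⊆C , _) =
  mutualVisibility-transfer T⊆C (C⊆V ∘ T⊆C)
    (liftShortestPath C⊆V (IsSCC⇒WalkClosed C-scc)) T-mv

scc-mutualVisibility⁺ : IsSCC D C → T ⊆ C → IsMutualVisibility D T →
                        IsMutualVisibility (induced D C) T
scc-mutualVisibility⁺ C-scc@(_ , (C⊆V , _) , _) T⊆C =
  mutualVisibility-transfer T⊆C T⊆C
    (restrictShortestPath C⊆V (IsSCC⇒WalkClosed C-scc))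

mainTheorem3 : ∀ {n} (D : Digraph n) (k : ℕ) → IsMu D k →
    (∀ C → IsSCC D C → ∀ j → IsMu (induced D C) j → j ≤ k) ×
    (Nonempty (verts D) → Σ (Subset n) λ C → IsSCC D C × IsMu (induced D C) k)
mainTheorem3 {n} D k ((S , S-mv , ∣S∣≡k) , S-maximum) = μ[C]≤k , μ-attained
  where
  μ[C]≤k : ∀ C → IsSCC D C → ∀ j → IsMu (induced D C) j → j ≤ k
  μ[C]≤k C C-scc j ((T , T-mv , ∣T∣≡j) , _) =
    subst (_≤ k) ∣T∣≡j (S-maximum T (scc-mutualVisibility⁻ C-scc T-mv))

  attainedAt : ∀ {x} → x ∈ verts D → S ⊆ sccOf D x →
               Σ (Subset n) λ C → IsSCC D C × IsMu (induced D C) k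
  attainedAt {x} x∈V S⊆C = sccOf D x , C-scc ,
    (S , scc-mutualVisibility⁺ C-scc S⊆C S-mv , ∣S∣≡k) ,
    λ T T-mv → S-maximum T (scc-mutualVisibility⁻ C-scc T-mv)
    where
    C-scc : IsSCC D (sccOf D x)
    C-scc = sccOf-isSCC x∈V

  μ-attained : Nonempty (verts D) → Σ (Subset n) λ C → IsSCC D C × IsMu (induced D C) k
  μ-attained (v , v∈V) with nonempty? S
  ... | no S-empty = attainedAt v∈V λ y∈S → ⊥-elim (S-empty (_ , y∈S))
  ... | yes (x , x∈S) = attainedAt (proj₁ S-mv x∈S) (mutualVisibility⇒⊆sccOf S-mv x∈S)
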